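{- For integers $k,r\ge0$ let $\mathcal{S}_k^{(r)}=\sum_{i=0}^k\binom{i}{2i-2r}Ps_k^{(i)}$. Then for $k\ge1$, $r\ge1$, \[ \mathcal{S}_k^{(r)}=-(k-1)^2\mathcal{S}_{k-1}^{(r)}+\mathcal{S}_{k-1}^{(r-1)}. \] With $\mathcal{S}_k=\sum_{r=0}^k\mathcal{S}_k^{(r)}$ and $\mathcal{S}_k^+=\sum_{r=0}^k|\mathcal{S}_k^{(r)}|$, one has $\mathcal{S}_0=\mathcal{S}_1=\mathcal{S}_0^+=\mathcal{S}_1^+=1$, and for $k\ge1$, $\mathcal{S}_k^+/\mathcal{S}_{k-1}^+=1+\sum_{t=1}^{k-1}(2t-1)=1+(k-1)^2$, \[ \mathcal{S}_k^+=\prod_{t=0}^{k-1}(1+t^2),\qquad \mathcal{S}_k=\prod_{t=0}^{k-1}(1-t^2), \] so $\mathcal{S}_k=0$ for $k\ge2$; and for $k\ge1$, $\prod_{t=0}^{k-1}(x-t^2)=\sum_{r=1}^k\mathcal{S}_k^{(r)}x^r$.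
   Context: The Legendre–Stirling numbers of the first kind $Ps_k^{(i)}$ are defined by $\prod_{j=0}^{k-1}\bigl(y-j(j+1)\bigr)=\sum_{i=0}^kPs_k^{(i)}y^i$. Binomial coefficients $\binom{i}{j}$ with $j<0$ or $j>i$ are $0$. -}

module Defs where

open import Data.Nat using (ℕ; zero; suc; _≡ᵇ_)
  renaming (_+_ to _+ℕ_; _*_ to _*ℕ_)
open import Data.Nat.Combinatorics using (_C_)
open import Data.Integer using (ℤ; +_; -[1+_]; _+_; _-_; _*_; -_; ∣_∣)
open import Data.Bool using (if_then_else_)

-- Polynomials with integer coefficients, represented by their coefficient
-- function: p n = coefficient of y^n.
Poly : Set
Poly = ℕ → ℤ

one : Poly
one zero    = + 1
one (suc _) = + 0

mulLin : ℤ → Poly → Poly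
mulLin c p zero    = - (c * p zero)
mulLin c p (suc i) = p i - c * p (suc i)

prodLin : ℕ → (ℕ → ℤ) → Poly
prodLin zero    a = one
prodLin (suc k) a = mulLin (a k) (prodLin k a)

monomial : ℤ → ℕ → Poly
monomial c r n = if n ≡ᵇ r then c else + 0

Ps : ℕ → ℕ → ℤ
Ps k i = prodLin k (λ j → + (j *ℕ suc j)) i

-- binomial coefficient with integer lower index (0 if j < 0 or j > i)
binomZ : ℕ → ℤ → ℤ
binomZ i (+ j)     = + (i C j)
binomZ i -[1+ _ ]  = + 0

sumBelow : ℕ → (ℕ → ℤ) → ℤ
sumBelow zero    f = + 0
sumBelow (suc n) f = sumBelow n f + f n

-- Σ_{i=a}^{b} f i  (empty if b < a)
sumFromTo : ℕ → ℕ → (ℕ → ℤ) → ℤ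
sumFromTo a b f = sumBelow (suc b Data.Nat.∸ a) (λ i → f (a +ℕ i))

prodBelow : ℕ → (ℕ → ℤ) → ℤ
prodBelow zero    f = + 1
prodBelow (suc n) f = prodBelow n f * f n

𝒮 : ℕ → ℕ → ℤ
𝒮 k r = sumFromTo 0 k (λ i → binomZ i (+ (2 *ℕ i) - + (2 *ℕ r)) * Ps k i)

𝒮tot : ℕ → ℤ
𝒮tot k = sumFromTo 0 k (λ r → 𝒮 k r)

𝒮⁺ : ℕ → ℤ
𝒮⁺ k = sumFromTo 0 k (λ r → + ∣ 𝒮 k r ∣)

sumPoly : ℕ → ℕ → (ℕ → ℤ) → Poly
sumPoly a b c n = sumFromTo a b (λ r → monomial (c r) r n)

-- Substituting y = x² + x turns ∏_{j<k} (y − j(j+1)) into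
-- ∏_{j<k} (x − j)(x + j + 1) = (x + k) · P(x²) / x  with  P(z) = ∏_{t<k} (z − t²),
-- and expanding (x² + x)^i by the binomial theorem shows that 𝒮_k^{(r)} is the
-- coefficient of x^{2r} of this product. Hence 𝒮_k^{(r)} is the coefficient of z^r
-- in P, which gives the recurrence and the coefficient identity; 𝒮_k is P(1), and,
-- since replacing z by −z only changes signs, 𝒮_k^+ = ∏_{t<k} (1 + t²).
module Submission where

open import Defs
open import Data.Nat using (ℕ; zero; suc; _≤_; _∸_)
open import Data.Integer using (ℤ; +_; _+_; _-_; _*_; -_)
open import Data.Product using (_×_)
open import Relation.Binary.PropositionalEquality using (_≡_)

open import Data.Nat as ℕ using (_<_; _≡ᵇ_; s≤s; z≤n)
import Data.Nat.Properties as ℕₚ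
open import Data.Nat.Combinatorics using (k>n⇒nCk≡0; nCk+nC[k+1]≡[n+1]C[k+1])
open import Data.Integer using (-[1+_]; ∣_∣; 0ℤ; -1ℤ; _^_; +≤+) renaming (_≤_ to _≤ℤ_)
open import Data.Integer.Properties
  using (pos-*; *-zeroʳ; *-identityˡ; *-comm; +-identityˡ; +-identityʳ; *-distribʳ-+; abs-*;
         +-mono-≤; *-monoˡ-≤-nonNeg; 0≤i⇒+∣i∣≡i)
open import Data.Integer.Solver using (module +-*-Solver)
open import Data.Product using (_,_)
open import Data.Sum using (inj₁; inj₂)
open import Data.Bool using (true; false)
open import Relation.Nullary using (contradiction)
open import Relation.Binary.PropositionalEquality
  using (refl; sym; trans; cong; cong₂; subst; _≢_; module ≡-Reasoning)
open +-*-Solver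

sumBelow-cong : ∀ n {f g : ℕ → ℤ} → (∀ i → f i ≡ g i) → sumBelow n f ≡ sumBelow n g
sumBelow-cong zero    f≗g = refl
sumBelow-cong (suc n) f≗g = cong₂ _+_ (sumBelow-cong n f≗g) (f≗g n)

prodBelow-cong : ∀ n {f g : ℕ → ℤ} → (∀ i → f i ≡ g i) → prodBelow n f ≡ prodBelow n g
prodBelow-cong zero    f≗g = refl
prodBelow-cong (suc n) f≗g = cong₂ _*_ (prodBelow-cong n f≗g) (f≗g n)

sumBelow-zero : ∀ n → sumBelow n (λ _ → + 0) ≡ + 0
sumBelow-zero zero    = refl
sumBelow-zero (suc n) = cong (_+ + 0) (sumBelow-zero n)

sumBelow-distrib-+ : ∀ n (f g : ℕ → ℤ) →
                     sumBelow n (λ i → f i + g i) ≡ sumBelow n f + sumBelow n g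
sumBelow-distrib-+ zero    f g = refl
sumBelow-distrib-+ (suc n) f g =
  trans (cong (_+ (f n + g n)) (sumBelow-distrib-+ n f g))
        (solve 4 (λ a b c d → (a :+ b) :+ (c :+ d) := (a :+ c) :+ (b :+ d)) refl
               (sumBelow n f) (sumBelow n g) (f n) (g n))

prodBelow-zero : ∀ n (f : ℕ → ℤ) {t} → t < n → f t ≡ + 0 → prodBelow n f ≡ + 0
prodBelow-zero (suc n) f {t} t<1+n ft≡0 with ℕₚ.m<1+n⇒m<n∨m≡n t<1+n
... | inj₁ t<n  = cong (_* f n) (prodBelow-zero n f t<n ft≡0)
... | inj₂ refl = trans (cong (prodBelow n f *_) ft≡0) (*-zeroʳ (prodBelow n f))

sumBelow-odd : ∀ n → sumBelow n (λ i → + 2 * + suc i - + 1) ≡ + n * + n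
sumBelow-odd zero    = refl
sumBelow-odd (suc n) =
  trans (cong (_+ (+ 2 * (+ 1 + + n) - + 1)) (sumBelow-odd n))
        (solve 1 (λ x → x :* x :+ (con (+ 2) :* (con (+ 1) :+ x) :- con (+ 1))
                        := (con (+ 1) :+ x) :* (con (+ 1) :+ x)) refl (+ n))

monomial-self : ∀ c n → monomial c n n ≡ c
monomial-self c n with n ≡ᵇ n | ℕₚ.≡⇒≡ᵇ n n refl
... | true | _ = refl

monomial-≢ : ∀ c {r n} → n ≢ r → monomial c r n ≡ + 0
monomial-≢ c {r} {n} n≢r with n ≡ᵇ r | ℕₚ.≡ᵇ⇒≡ n r
... | false | _    = refl
... | true  | n≡r = contradiction (n≡r _) n≢r

sumBelow-monomial-≥ : ∀ k (c : ℕ → ℤ) {n} → k ≤ n →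
                      sumBelow k (λ i → monomial (c i) i n) ≡ + 0
sumBelow-monomial-≥ zero    c k≤n = refl
sumBelow-monomial-≥ (suc k) c k<n =
  cong₂ _+_ (sumBelow-monomial-≥ k c (ℕₚ.<⇒≤ k<n))
            (monomial-≢ (c k) (λ n≡k → ℕₚ.<-irrefl (sym n≡k) k<n))

sumBelow-monomial-< : ∀ k (c : ℕ → ℤ) {n} → n < k →
                      sumBelow k (λ i → monomial (c i) i n) ≡ c n
sumBelow-monomial-< (suc k) c {n} n<1+k with ℕₚ.m<1+n⇒m<n∨m≡n n<1+k
... | inj₁ n<k  = trans (cong₂ _+_ (sumBelow-monomial-< k c n<k) (monomial-≢ (c k) (ℕₚ.<⇒≢ n<k)))
                        (+-identityʳ (c n))
... | inj₂ refl = trans (cong₂ _+_ (sumBelow-monomial-≥ n c ℕₚ.≤-refl) (monomial-self (c n) n))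
                        (+-identityˡ (c n))

prodLin-degree : ∀ k (a : ℕ → ℤ) {n} → k < n → prodLin k a n ≡ + 0
prodLin-degree zero    a {suc n} _         = refl
prodLin-degree (suc k) a {suc n} (s≤s k<n) =
  trans (cong₂ (λ p q → p - a k * q) (prodLin-degree k a k<n)
                                     (prodLin-degree k a (ℕₚ.m≤n⇒m≤1+n k<n)))
        (cong (λ x → + 0 - x) (*-zeroʳ (a k)))

prodLin-constant : ∀ k (a : ℕ → ℤ) → a 0 ≡ + 0 → prodLin (suc k) a 0 ≡ + 0
prodLin-constant zero    a a0≡0 = cong (λ c → - (c * + 1)) a0≡0
prodLin-constant (suc k) a a0≡0 =
  trans (cong (λ p → - (a (suc k) * p)) (prodLin-constant k a a0≡0))
        (cong -_ (*-zeroʳ (a (suc k))))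

sumBelow-weighted-mulLin :
  ∀ n (w : ℕ → ℤ) (c : ℤ) (p : Poly) →
  sumBelow (suc n) (λ i → w i * mulLin c p i) ≡
  sumBelow n (λ i → w (suc i) * p i) - c * sumBelow (suc n) (λ i → w i * p i)
sumBelow-weighted-mulLin zero w c p =
  solve 3 (λ w c p → con (+ 0) :+ w :* (:- (c :* p)) := con (+ 0) :- c :* (con (+ 0) :+ w :* p))
        refl (w 0) c (p 0)
sumBelow-weighted-mulLin (suc n) w c p =
  trans (cong (_+ (w (suc n) * (p n - c * p (suc n)))) (sumBelow-weighted-mulLin n w c p))
        (solve 6 (λ A B c w x y → (A :- c :* B) :+ w :* (x :- c :* y)
                                 := (A :+ w :* x) :- c :* (B :+ w :* y)) refl
               (sumBelow n (λ i → w (suc i) * p i)) (sumBelow (suc n) (λ i → w i * p i))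
               c (w (suc n)) (p n) (p (suc n)))

sumBelow-prodLin : ∀ k (a : ℕ → ℤ) →
                   sumBelow (suc k) (prodLin k a) ≡ prodBelow k (λ t → + 1 - a t)
sumBelow-prodLin zero    a = refl
sumBelow-prodLin (suc k) a = begin
  sumBelow (suc (suc k)) (prodLin (suc k) a)
    ≡⟨ sumBelow-cong (suc (suc k)) (λ i → sym (*-identityˡ (prodLin (suc k) a i))) ⟩
  sumBelow (suc (suc k)) (λ i → + 1 * mulLin (a k) p i)
    ≡⟨ sumBelow-weighted-mulLin (suc k) (λ _ → + 1) (a k) p ⟩
  sumBelow (suc k) (λ i → + 1 * p i) - a k * sumBelow (suc (suc k)) (λ i → + 1 * p i)
    ≡⟨ cong₂ (λ s s′ → s - a k * s′) (sumBelow-cong (suc k) one*p) (sumBelow-cong (suc (suc k)) one*p) ⟩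
  S - a k * (S + p (suc k))
    ≡⟨ cong (λ x → S - a k * (S + x)) (prodLin-degree k a (ℕₚ.n<1+n k)) ⟩
  S - a k * (S + + 0)
    ≡⟨ solve 2 (λ S c → S :- c :* (S :+ con (+ 0)) := S :* (con (+ 1) :- c)) refl S (a k) ⟩
  S * (+ 1 - a k)
    ≡⟨ cong (_* (+ 1 - a k)) (sumBelow-prodLin k a) ⟩
  prodBelow (suc k) (λ t → + 1 - a t) ∎
  where
  open ≡-Reasoning
  p = prodLin k a
  S = sumBelow (suc k) p
  one*p : ∀ i → + 1 * p i ≡ p i
  one*p i = *-identityˡ (p i)

prodLin-neg : ∀ k (a : ℕ → ℤ) r →
              prodLin k (λ t → - a t) r ≡ -1ℤ ^ (k ℕ.+ r) * prodLin k a r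
prodLin-neg zero a zero    = refl
prodLin-neg zero a (suc r) = sym (*-zeroʳ (-1ℤ ^ suc r))
prodLin-neg (suc k) a zero = begin
  - (- a k * p⁻ 0)         ≡⟨ cong (λ x → - (- a k * x)) (prodLin-neg k a 0) ⟩
  - (- a k * (s * p 0))     ≡⟨ solve 3 (λ c s x → :- (:- c :* (s :* x)) := (con -1ℤ :* s) :* (:- (c :* x)))
                                     refl (a k) s (p 0) ⟩
  (-1ℤ * s) * - (a k * p 0) ∎
  where
  open ≡-Reasoning
  p = prodLin k a
  p⁻ = prodLin k (λ t → - a t)
  s = -1ℤ ^ (k ℕ.+ 0)
prodLin-neg (suc k) a (suc r) = begin
  p⁻ r - (- a k) * p⁻ (suc r)
    ≡⟨ cong₂ (λ x y → x - (- a k) * y) (prodLin-neg k a r) (prodLin-neg k a (suc r)) ⟩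
  s * p r - (- a k) * (-1ℤ ^ (k ℕ.+ suc r) * p (suc r))
    ≡⟨ cong (λ n → s * p r - (- a k) * (-1ℤ ^ n * p (suc r))) (ℕₚ.+-suc k r) ⟩
  s * p r - (- a k) * ((-1ℤ * s) * p (suc r))
    ≡⟨ solve 4 (λ s c x y → s :* x :- (:- c) :* ((con -1ℤ :* s) :* y)
                            := (con -1ℤ :* (con -1ℤ :* s)) :* (x :- c :* y)) refl s (a k) (p r) (p (suc r)) ⟩
  (-1ℤ * (-1ℤ * s)) * (p r - a k * p (suc r))
    ≡⟨ cong (λ n → -1ℤ * -1ℤ ^ n * (p r - a k * p (suc r))) (sym (ℕₚ.+-suc k r)) ⟩
  -1ℤ ^ (suc k ℕ.+ suc r) * prodLin (suc k) a (suc r) ∎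
  where
  open ≡-Reasoning
  p = prodLin k a
  p⁻ = prodLin k (λ t → - a t)
  s = -1ℤ ^ (k ℕ.+ r)

∣-1^n*i∣≡∣i∣ : ∀ n i → ∣ -1ℤ ^ n * i ∣ ≡ ∣ i ∣
∣-1^n*i∣≡∣i∣ n i = trans (abs-* (-1ℤ ^ n) i)
                          (trans (cong (ℕ._* ∣ i ∣) (∣-1^n∣≡1 n)) (ℕₚ.*-identityˡ ∣ i ∣))
  where
  ∣-1^n∣≡1 : ∀ n → ∣ -1ℤ ^ n ∣ ≡ 1
  ∣-1^n∣≡1 zero    = refl
  ∣-1^n∣≡1 (suc n) = trans (abs-* -1ℤ (-1ℤ ^ n)) (trans (ℕₚ.+-identityʳ _) (∣-1^n∣≡1 n))

0≤+n*i : ∀ n {i} → 0ℤ ≤ℤ i → 0ℤ ≤ℤ + n * i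
0≤+n*i n {i} 0≤i = subst (_≤ℤ + n * i) (*-zeroʳ (+ n)) (*-monoˡ-≤-nonNeg (+ n) 0≤i)

prodLin-neg-nonNeg : ∀ k (a : ℕ → ℕ) r → 0ℤ ≤ℤ prodLin k (λ t → - + a t) r
prodLin-neg-nonNeg zero    a zero    = +≤+ z≤n
prodLin-neg-nonNeg zero    a (suc r) = +≤+ z≤n
prodLin-neg-nonNeg (suc k) a zero    =
  subst (0ℤ ≤ℤ_) (solve 2 (λ c x → c :* x := :- (:- c :* x)) refl (+ a k) (p 0))
        (0≤+n*i (a k) (prodLin-neg-nonNeg k a 0))
  where p = prodLin k (λ t → - + a t)
prodLin-neg-nonNeg (suc k) a (suc r) =
  subst (0ℤ ≤ℤ_) (solve 3 (λ c x y → x :+ c :* y := x :- (:- c) :* y) refl (+ a k) (p r) (p (suc r)))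
        (+-mono-≤ (prodLin-neg-nonNeg k a r) (0≤+n*i (a k) (prodLin-neg-nonNeg k a (suc r))))
  where p = prodLin k (λ t → - + a t)

∣prodLin-neg∣ : ∀ k (a : ℕ → ℕ) r → + ∣ prodLin k (λ t → + a t) r ∣ ≡ prodLin k (λ t → - + a t) r
∣prodLin-neg∣ k a r = begin
  + ∣ prodLin k (λ t → + a t) r ∣                  ≡⟨ cong +_ (sym (∣-1^n*i∣≡∣i∣ (k ℕ.+ r) _)) ⟩
  + ∣ -1ℤ ^ (k ℕ.+ r) * prodLin k (λ t → + a t) r ∣ ≡⟨ cong (λ x → + ∣ x ∣) (sym (prodLin-neg k (λ t → + a t) r)) ⟩
  + ∣ prodLin k (λ t → - + a t) r ∣                ≡⟨ 0≤i⇒+∣i∣≡i (prodLin-neg-nonNeg k a r) ⟩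
  prodLin k (λ t → - + a t) r                      ∎
  where open ≡-Reasoning

binomZ-suc : ∀ i j → binomZ (suc i) j ≡ binomZ i (j - + 1) + binomZ i j
binomZ-suc i (+ zero)  = refl
binomZ-suc i (+ suc n) = cong +_ (sym (nCk+nC[k+1]≡[n+1]C[k+1] i n))
binomZ-suc i -[1+ n ]  = refl

-- The coefficient of x^m in ∏_{j<k} ((x² + x) − j(j+1)), because
-- (x² + x)^i = Σ_j binom(i, j) x^{2i−j}.
substCoeff : ℕ → ℤ → ℤ
substCoeff k m = sumBelow (suc k) (λ i → binomZ i (+ (2 ℕ.* i) - m) * Ps k i)

substCoeff-neg : ∀ k n → substCoeff k -[1+ n ] ≡ + 0
substCoeff-neg k n = trans (sumBelow-cong (suc k) vanish) (sumBelow-zero (suc k))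
  where
  vanish : ∀ i → binomZ i (+ (2 ℕ.* i) - -[1+ n ]) * Ps k i ≡ + 0
  vanish i = cong (λ b → + b * Ps k i) (k>n⇒nCk≡0 i<2i+1+n)
    where
    i<2i+1+n : i < 2 ℕ.* i ℕ.+ suc n
    i<2i+1+n = ℕₚ.<-≤-trans (ℕₚ.m<m+n i (s≤s z≤n)) (ℕₚ.+-monoˡ-≤ (suc n) (ℕₚ.m≤m+n i (i ℕ.+ 0)))

binomZ-suc-shifted : ∀ i m →
  binomZ (suc i) (+ (2 ℕ.* suc i) - m) ≡
  binomZ i (+ (2 ℕ.* i) - (m - + 1)) + binomZ i (+ (2 ℕ.* i) - (m - + 2))
binomZ-suc-shifted i m = begin
  binomZ (suc i) (+ (2 ℕ.* suc i) - m)
    ≡⟨ cong (λ n → binomZ (suc i) (+ n - m)) (ℕₚ.*-suc 2 i) ⟩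
  binomZ (suc i) (+ 2 + D - m)
    ≡⟨ binomZ-suc i (+ 2 + D - m) ⟩
  binomZ i (+ 2 + D - m - + 1) + binomZ i (+ 2 + D - m)
    ≡⟨ cong₂ (λ x y → binomZ i x + binomZ i y)
             (solve 2 (λ D m → con (+ 2) :+ D :- m :- con (+ 1) := D :- (m :- con (+ 1))) refl D m)
             (solve 2 (λ D m → con (+ 2) :+ D :- m := D :- (m :- con (+ 2))) refl D m) ⟩
  binomZ i (D - (m - + 1)) + binomZ i (D - (m - + 2)) ∎
  where
  open ≡-Reasoning
  D = + (2 ℕ.* i)

substCoeff-suc : ∀ k m →
  substCoeff (suc k) m ≡
  substCoeff k (m - + 1) + substCoeff k (m - + 2) - + k * (+ 1 + + k) * substCoeff k m
substCoeff-suc k m = begin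
  substCoeff (suc k) m
    ≡⟨ sumBelow-weighted-mulLin (suc k) (λ i → B i m) c (Ps k) ⟩
  sumBelow (suc k) (λ i → B (suc i) m * Ps k i) - c * (W₀ + B (suc k) m * Ps k (suc k))
    ≡⟨ cong₂ (λ x y → x - c * (W₀ + B (suc k) m * y))
             (sumBelow-cong (suc k) pascal) (prodLin-degree k _ (ℕₚ.n<1+n k)) ⟩
  sumBelow (suc k) (λ i → B i (m - + 1) * Ps k i + B i (m - + 2) * Ps k i)
    - c * (W₀ + B (suc k) m * + 0)
    ≡⟨ cong₂ (λ x y → x - y * (W₀ + B (suc k) m * + 0))
             (sumBelow-distrib-+ (suc k) _ _) (pos-* k (suc k)) ⟩
  W₁ + W₂ - + k * (+ 1 + + k) * (W₀ + B (suc k) m * + 0)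
    ≡⟨ solve 5 (λ x y K z b → x :+ y :- K :* (con (+ 1) :+ K) :* (z :+ b :* con (+ 0))
                             := x :+ y :- K :* (con (+ 1) :+ K) :* z) refl W₁ W₂ (+ k) W₀ (B (suc k) m) ⟩
  W₁ + W₂ - + k * (+ 1 + + k) * W₀ ∎
  where
  open ≡-Reasoning
  B : ℕ → ℤ → ℤ
  B i m = binomZ i (+ (2 ℕ.* i) - m)
  c = + (k ℕ.* suc k)
  W₀ = substCoeff k m
  W₁ = substCoeff k (m - + 1)
  W₂ = substCoeff k (m - + 2)
  pascal : ∀ i → B (suc i) m * Ps k i ≡ B i (m - + 1) * Ps k i + B i (m - + 2) * Ps k i
  pascal i = trans (cong (_* Ps k i) (binomZ-suc-shifted i m))
                   (*-distribʳ-+ (Ps k i) (B i (m - + 1)) (B i (m - + 2)))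

substCoeff-step : ∀ k m {x y z} →
  substCoeff k (m - + 1) ≡ x → substCoeff k (m - + 2) ≡ y → substCoeff k m ≡ z →
  substCoeff (suc k) m ≡ x + y - + k * (+ 1 + + k) * z
substCoeff-step k m refl refl refl = substCoeff-suc k m

sq : ℕ → ℤ
sq t = + (t ℕ.* t)

squarePoly : ℕ → Poly
squarePoly k = prodLin k sq

squarePoly-suc-zero : ∀ k → squarePoly (suc k) 0 ≡ - (+ k * + k * squarePoly k 0)
squarePoly-suc-zero k = cong (λ c → - (c * squarePoly k 0)) (pos-* k k)

squarePoly-suc-suc : ∀ k r →
  squarePoly (suc k) (suc r) ≡ squarePoly k r - + k * + k * squarePoly k (suc r)
squarePoly-suc-suc k r = cong (λ c → squarePoly k r - c * squarePoly k (suc r)) (pos-* k k)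

k*squarePoly-zero : ∀ k → + k * squarePoly k 0 ≡ + 0
k*squarePoly-zero zero    = refl
k*squarePoly-zero (suc k) =
  trans (cong (+ suc k *_) (prodLin-constant k sq refl)) (*-zeroʳ (+ suc k))

substCoeff-even : ∀ k r → substCoeff k (+ (2 ℕ.* r)) ≡ squarePoly k r
substCoeff-odd  : ∀ k r → substCoeff k (+ suc (2 ℕ.* r)) ≡ + k * squarePoly k (suc r)

substCoeff-even zero zero    = refl
substCoeff-even zero (suc r) = refl
substCoeff-even (suc k) zero = begin
  substCoeff (suc k) (+ 0)
    ≡⟨ substCoeff-step k (+ 0) (substCoeff-neg k 0) (substCoeff-neg k 1) (substCoeff-even k 0) ⟩
  + 0 + + 0 - K * (+ 1 + K) * Q 0
    ≡⟨ solve 2 (λ K q → con (+ 0) :+ con (+ 0) :- K :* (con (+ 1) :+ K) :* q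
                       := :- (K :* K :* q) :- K :* q) refl K (Q 0) ⟩
  - (K * K * Q 0) - K * Q 0
    ≡⟨ cong (λ x → - (K * K * Q 0) - x) (k*squarePoly-zero k) ⟩
  - (K * K * Q 0) - + 0
    ≡⟨ +-identityʳ _ ⟩
  - (K * K * Q 0)
    ≡⟨ sym (squarePoly-suc-zero k) ⟩
  squarePoly (suc k) 0 ∎
  where
  open ≡-Reasoning
  K = + k
  Q = squarePoly k
substCoeff-even (suc k) (suc r) = begin
  substCoeff (suc k) (+ (2 ℕ.* suc r))
    ≡⟨ substCoeff-step k (+ (2 ℕ.* suc r))
         (trans (cong (λ n → substCoeff k (+ n - + 1)) (ℕₚ.*-suc 2 r)) (substCoeff-odd k r))
         (trans (cong (λ n → substCoeff k (+ n - + 2)) (ℕₚ.*-suc 2 r)) (substCoeff-even k r))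
         (substCoeff-even k (suc r)) ⟩
  K * Q (suc r) + Q r - K * (+ 1 + K) * Q (suc r)
    ≡⟨ solve 3 (λ K x y → K :* y :+ x :- K :* (con (+ 1) :+ K) :* y := x :- K :* K :* y)
             refl K (Q r) (Q (suc r)) ⟩
  Q r - K * K * Q (suc r)
    ≡⟨ sym (squarePoly-suc-suc k r) ⟩
  squarePoly (suc k) (suc r) ∎
  where
  open ≡-Reasoning
  K = + k
  Q = squarePoly k

substCoeff-odd zero r = refl
substCoeff-odd (suc k) zero = begin
  substCoeff (suc k) (+ 1)
    ≡⟨ substCoeff-step k (+ 1) (substCoeff-even k 0) (substCoeff-neg k 0) (substCoeff-odd k 0) ⟩
  Q 0 + + 0 - K * (+ 1 + K) * (K * Q 1)
    ≡⟨ solve 3 (λ K x y → x :+ con (+ 0) :- K :* (con (+ 1) :+ K) :* (K :* y)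
                         := (con (+ 1) :+ K) :* (x :- K :* K :* y) :- K :* x) refl K (Q 0) (Q 1) ⟩
  (+ 1 + K) * (Q 0 - K * K * Q 1) - K * Q 0
    ≡⟨ cong (λ x → (+ 1 + K) * (Q 0 - K * K * Q 1) - x) (k*squarePoly-zero k) ⟩
  (+ 1 + K) * (Q 0 - K * K * Q 1) - + 0
    ≡⟨ +-identityʳ _ ⟩
  (+ 1 + K) * (Q 0 - K * K * Q 1)
    ≡⟨ cong ((+ 1 + K) *_) (sym (squarePoly-suc-suc k 0)) ⟩
  + suc k * squarePoly (suc k) 1 ∎
  where
  open ≡-Reasoning
  K = + k
  Q = squarePoly k
substCoeff-odd (suc k) (suc r) = begin
  substCoeff (suc k) (+ suc (2 ℕ.* suc r))
    ≡⟨ substCoeff-step k (+ suc (2 ℕ.* suc r))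
         (substCoeff-even k (suc r))
         (trans (cong (λ n → substCoeff k (+ suc n - + 2)) (ℕₚ.*-suc 2 r)) (substCoeff-odd k r))
         (substCoeff-odd k (suc r)) ⟩
  Q (suc r) + K * Q (suc r) - K * (+ 1 + K) * (K * Q (suc (suc r)))
    ≡⟨ solve 3 (λ K x y → x :+ K :* x :- K :* (con (+ 1) :+ K) :* (K :* y)
                         := (con (+ 1) :+ K) :* (x :- K :* K :* y)) refl K (Q (suc r)) (Q (suc (suc r))) ⟩
  (+ 1 + K) * (Q (suc r) - K * K * Q (suc (suc r)))
    ≡⟨ cong ((+ 1 + K) *_) (sym (squarePoly-suc-suc k (suc r))) ⟩
  + suc k * squarePoly (suc k) (suc (suc r)) ∎
  where
  open ≡-Reasoning
  K = + k
  Q = squarePoly k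

𝒮≡squarePoly : ∀ k r → 𝒮 k r ≡ squarePoly k r
𝒮≡squarePoly = substCoeff-even

𝒮-recurrence : ∀ k r → 𝒮 (suc k) (suc r) ≡ - (+ k * + k) * 𝒮 k (suc r) + 𝒮 k r
𝒮-recurrence k r = begin
  𝒮 (suc k) (suc r)                            ≡⟨ 𝒮≡squarePoly (suc k) (suc r) ⟩
  squarePoly (suc k) (suc r)                   ≡⟨ squarePoly-suc-suc k r ⟩
  Q r - + k * + k * Q (suc r)                  ≡⟨ solve 3 (λ K x y → x :- K :* K :* y := :- (K :* K) :* y :+ x)
                                                        refl (+ k) (Q r) (Q (suc r)) ⟩
  - (+ k * + k) * Q (suc r) + Q r              ≡⟨ sym (cong₂ (λ x y → - (+ k * + k) * x + y)
                                                             (𝒮≡squarePoly k (suc r)) (𝒮≡squarePoly k r)) ⟩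
  - (+ k * + k) * 𝒮 k (suc r) + 𝒮 k r          ∎
  where
  open ≡-Reasoning
  Q = squarePoly k

𝒮tot≡∏ : ∀ k → 𝒮tot k ≡ prodBelow k (λ t → + 1 - + t * + t)
𝒮tot≡∏ k = begin
  𝒮tot k                                  ≡⟨ sumBelow-cong (suc k) (𝒮≡squarePoly k) ⟩
  sumBelow (suc k) (squarePoly k)          ≡⟨ sumBelow-prodLin k sq ⟩
  prodBelow k (λ t → + 1 - sq t)           ≡⟨ prodBelow-cong k (λ t → cong (λ x → + 1 - x) (pos-* t t)) ⟩
  prodBelow k (λ t → + 1 - + t * + t)      ∎
  where open ≡-Reasoning

𝒮tot-vanishes : ∀ k → 2 ≤ k → 𝒮tot k ≡ + 0
𝒮tot-vanishes k 1<k = trans (𝒮tot≡∏ k) (prodBelow-zero k _ 1<k refl)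

𝒮⁺≡∏ : ∀ k → 𝒮⁺ k ≡ prodBelow k (λ t → + 1 + + t * + t)
𝒮⁺≡∏ k = begin
  𝒮⁺ k                                             ≡⟨ sumBelow-cong (suc k) ∣𝒮∣ ⟩
  sumBelow (suc k) (prodLin k (λ t → - sq t))       ≡⟨ sumBelow-prodLin k (λ t → - sq t) ⟩
  prodBelow k (λ t → + 1 - - sq t)                  ≡⟨ prodBelow-cong k 1+sq ⟩
  prodBelow k (λ t → + 1 + + t * + t)               ∎
  where
  open ≡-Reasoning
  ∣𝒮∣ : ∀ r → + ∣ 𝒮 k r ∣ ≡ prodLin k (λ t → - sq t) r
  ∣𝒮∣ r = trans (cong (λ x → + ∣ x ∣) (𝒮≡squarePoly k r)) (∣prodLin-neg∣ k (λ t → t ℕ.* t) r)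
  1+sq : ∀ t → + 1 - - sq t ≡ + 1 + + t * + t
  1+sq t = trans (solve 1 (λ x → con (+ 1) :- (:- x) := con (+ 1) :+ x) refl (sq t))
                 (cong (λ x → + 1 + x) (pos-* t t))

𝒮⁺-ratio : ∀ k → 𝒮⁺ (suc k) ≡ (+ 1 + + k * + k) * 𝒮⁺ k
𝒮⁺-ratio k = begin
  𝒮⁺ (suc k)              ≡⟨ 𝒮⁺≡∏ (suc k) ⟩
  P * (+ 1 + + k * + k)   ≡⟨ *-comm P (+ 1 + + k * + k) ⟩
  (+ 1 + + k * + k) * P   ≡⟨ cong ((+ 1 + + k * + k) *_) (sym (𝒮⁺≡∏ k)) ⟩
  (+ 1 + + k * + k) * 𝒮⁺ k ∎
  where
  open ≡-Reasoning
  P = prodBelow k (λ t → + 1 + + t * + t)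

squarePoly≡sumPoly-𝒮 : ∀ k n → squarePoly (suc k) n ≡ sumPoly 1 (suc k) (𝒮 (suc k)) n
squarePoly≡sumPoly-𝒮 k zero = trans (prodLin-constant k sq refl) (sym (sumBelow-zero (suc k)))
squarePoly≡sumPoly-𝒮 k (suc m) with ℕₚ.<-≤-connex m (suc k)
... | inj₁ m<1+k = sym (trans (sumBelow-monomial-< (suc k) (λ r → 𝒮 (suc k) (suc r)) m<1+k)
                              (𝒮≡squarePoly (suc k) (suc m)))
... | inj₂ 1+k≤m = trans (prodLin-degree (suc k) sq (s≤s 1+k≤m))
                         (sym (sumBelow-monomial-≥ (suc k) (λ r → 𝒮 (suc k) (suc r)) 1+k≤m))

lemma4p7 : ((k r : ℕ) → 1 ≤ k → 1 ≤ r →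
        𝒮 k r ≡ - (+ (k ∸ 1) * + (k ∸ 1)) * 𝒮 (k ∸ 1) r + 𝒮 (k ∸ 1) (r ∸ 1))
    × (𝒮tot 0 ≡ + 1) × (𝒮tot 1 ≡ + 1) × (𝒮⁺ 0 ≡ + 1) × (𝒮⁺ 1 ≡ + 1)
    × ((k : ℕ) → 1 ≤ k →
        (𝒮⁺ k ≡ (+ 1 + sumFromTo 1 (k ∸ 1) (λ t → + 2 * + t - + 1)) * 𝒮⁺ (k ∸ 1))
        × (+ 1 + sumFromTo 1 (k ∸ 1) (λ t → + 2 * + t - + 1) ≡ + 1 + + (k ∸ 1) * + (k ∸ 1)))
    × ((k : ℕ) → 𝒮⁺ k ≡ prodBelow k (λ t → + 1 + + t * + t))
    × ((k : ℕ) → 𝒮tot k ≡ prodBelow k (λ t → + 1 - + t * + t))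
    × ((k : ℕ) → 2 ≤ k → 𝒮tot k ≡ + 0)
    × ((k : ℕ) → 1 ≤ k → (n : ℕ) →
        prodLin k (λ t → + (t Data.Nat.* t)) n ≡ sumPoly 1 k (𝒮 k) n)
lemma4p7 =
  (λ { (suc k) (suc r) _ _ → 𝒮-recurrence k r }) ,
  refl , refl , refl , refl ,
  (λ { (suc k) _ → let odd-sum = cong (λ x → + 1 + x) (sumBelow-odd k)
                   in trans (𝒮⁺-ratio k) (cong (_* 𝒮⁺ k) (sym odd-sum)) , odd-sum }) ,
  𝒮⁺≡∏ , 𝒮tot≡∏ , 𝒮tot-vanishes ,
  (λ { (suc k) _ → squarePoly≡sumPoly-𝒮 k })
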